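{- Let $w\in\widetilde{S}_n$ avoid the patterns $3412$ and $4231$. Then $w$ or $w^{ -1}$ (or both) has a factoring subword.
   Context: $\widetilde{S}_n$ is the set of bijections $w:\mathbb{Z}\to\mathbb{Z}$ with $w(i+n)=w(i)+n$ and $\sum_{i=1}^n w(i)=\binom{n+1}{2}$; write $w_i=w(i)$; $w^{ -1}$ is the inverse bijection (also in $\widetilde{S}_n$). Pattern containment: $w$ contains $p\in S_k$ if there exist integers $i_1<\dots<i_k$ with $w_{i_1},\dots,w_{i_k}$ in the same relative order as $p$. A factoring subword of $w$ is a consecutive subsequence $x=x_1\cdots x_k=w_{q+1}w_{q+2}\cdots w_{q+k}$ ($k\ge1$, $q\in\mathbb{Z}$) such that: (1) $x_1>x_2>\dots>x_k$; (2) $x_1>w_i$ for all $i\le q$; (3) $x_k<w_i$ for all $i>q+k$; (4) if $x_k>w_i$ for all $i\le q$, then $w_i>x_1$ for all $i>q+k$. -}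

module Defs where

open import Data.Nat as ℕ using (ℕ; zero; suc)
open import Data.Nat.Combinatorics using (_C_)
open import Data.Integer as ℤ using (ℤ; +_; _+_; _<_; _≤_)
open import Data.Fin using (Fin; toℕ)
open import Data.Vec using (Vec; lookup; []; _∷_)
open import Data.Product using (Σ; ∃; _×_)
open import Relation.Binary.PropositionalEquality using (_≡_)
open import Relation.Nullary using (¬_)

sumTo : (ℤ → ℤ) → ℕ → ℤ
sumTo w zero = + 0
sumTo w (suc m) = sumTo w m + w (+ suc m)

IsAffinePerm : ℕ → (ℤ → ℤ) → (ℤ → ℤ) → Set
IsAffinePerm n w winv =
  (∀ i → winv (w i) ≡ i) ×
  (∀ i → w (winv i) ≡ i) ×
  (∀ i → w (i + + n) ≡ w i + + n) ×
  (sumTo w n ≡ + (suc n C 2))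

Contains : (ℤ → ℤ) → {k : ℕ} → Vec ℕ k → Set
Contains w {k} p =
  Σ (Fin k → ℤ) λ pos →
    (∀ a b → toℕ a ℕ.< toℕ b → pos a < pos b) ×
    (∀ a b → (lookup p a ℕ.< lookup p b → w (pos a) < w (pos b)) ×
             (w (pos a) < w (pos b) → lookup p a ℕ.< lookup p b))

Avoids : (ℤ → ℤ) → {k : ℕ} → Vec ℕ k → Set
Avoids w p = ¬ Contains w p

p3412 : Vec ℕ 4
p3412 = 3 ∷ 4 ∷ 1 ∷ 2 ∷ []

p4231 : Vec ℕ 4
p4231 = 4 ∷ 2 ∷ 3 ∷ 1 ∷ []

-- x = w_{q+1} ⋯ w_{q+k} is a factoring subword of w
IsFactoringSubword : (ℤ → ℤ) → ℤ → ℕ → Set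
IsFactoringSubword w q k =
  (1 ℕ.≤ k) ×
  (∀ j → 1 ℕ.≤ j → j ℕ.< k → w (q + + suc j) < w (q + + j)) ×
  (∀ i → i ≤ q → w i < w (q + + 1)) ×
  (∀ i → q + + k < i → w (q + + k) < w i) ×
  ((∀ i → i ≤ q → w i < w (q + + k)) →
     ∀ i → q + + k < i → w (q + + 1) < w i)

HasFactoringSubword : (ℤ → ℤ) → Set
HasFactoringSubword w = Σ ℤ λ q → Σ ℕ λ k → IsFactoringSubword w q k

module Submission where

-- Choose d ≤ e with w(d) maximal on (-∞, e] and w(e) minimal on [d, ∞); such extrema exist because
-- w(i + n) = w(i) + n reduces every half-line extremum to one over n consecutive positions.  If w
-- descends on [d, e], the block is a factoring subword as soon as condition (4) holds; comparing w(e)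
-- with the maximum w(d₀) of w on (-∞, d - 1] either makes the premise of (4) fail or replaces the
-- block by [d₀, d - 1], for which the conclusion of (4) holds.  An ascent of w inside the block
-- yields a 4231 or a 3412, unless w⁻¹ descends on [w(e), w(d)], and then that block is a factoring
-- subword of w⁻¹; an ascent of w⁻¹ there again yields one of the two patterns.

open import Defs
open import Data.Nat as ℕ using (ℕ; zero; suc; s≤s; z≤n)
import Data.Nat.Properties as ℕ
open import Data.Nat.DivMod using (_%_; _/_; m≡m%n+[m/n]*n; m%n<n)
open import Data.Integer as ℤ using (ℤ; +_; 0ℤ; 1ℤ; +≤+; +<+)
import Data.Integer.Properties as ℤ
open import Data.Integer.Tactic.RingSolver using (solve-∀)
open import Data.Fin using (Fin; toℕ) renaming (zero to 0F; suc to sucF)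
open import Data.Fin.Properties using (toℕ<n)
open import Data.Vec using (Vec; lookup)
open import Data.List using (applyUpTo)
open import Data.List.Relation.Unary.All.Properties using (applyUpTo⁺₂; applyUpTo⁻)
open import Data.Product using (Σ; _×_; _,_)
open import Data.Sum using (_⊎_; inj₁; inj₂; [_,_])
open import Data.Empty using (⊥; ⊥-elim)
open import Function using (_∘_)
open import Relation.Nullary using (yes; no)
open import Relation.Binary.Definitions using (tri<; tri≈; tri>)
open import Relation.Binary.PropositionalEquality
  using (_≡_; _≢_; refl; sym; trans; cong; subst; subst₂; ≢-sym; module ≡-Reasoning)

module Patterns where
  open import Data.Integer using (_<_)
  open import Data.Integer.Properties using (<-trans; <-irrefl; <-asym)

  StrictlyIncreasingBelow : ℕ → (ℕ → ℤ) → Set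
  StrictlyIncreasingBelow k g = ∀ {i j} → i ℕ.< j → j ℕ.< k → g i < g j

  strictlyIncreasingBelow-by-steps : ∀ k (g : ℕ → ℤ) →
    (∀ i → suc i ℕ.< k → g i < g (suc i)) → StrictlyIncreasingBelow k g
  strictlyIncreasingBelow-by-steps k g step = go
    where
    go : StrictlyIncreasingBelow k g
    go {i} {suc j} i<1+j 1+j<k with ℕ.m≤n⇒m<n∨m≡n (ℕ.s≤s⁻¹ i<1+j)
    ... | inj₁ i<j    = <-trans (go i<j (ℕ.<-trans (ℕ.n<1+n j) 1+j<k)) (step j 1+j<k)
    ... | inj₂ refl   = step i 1+j<k

  strictlyIncreasingBelow-reflects : ∀ {k g} → StrictlyIncreasingBelow k g →
    ∀ {i j} → i ℕ.< k → j ℕ.< k → g i < g j → i ℕ.< j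
  strictlyIncreasingBelow-reflects g↑ {i} {j} i<k j<k gi<gj with ℕ.<-cmp i j
  ... | tri< i<j _ _ = i<j
  ... | tri≈ _ refl _ = ⊥-elim (<-irrefl refl gi<gj)
  ... | tri> _ _ j<i = ⊥-elim (<-asym gi<gj (g↑ j<i i<k))

  contains-by-ranks : ∀ {k} (w : ℤ → ℤ) (p : Vec ℕ k) (rank : Fin k → Fin k) (pos val : ℕ → ℤ) →
    StrictlyIncreasingBelow k pos → StrictlyIncreasingBelow k val →
    (∀ a → lookup p a ≡ suc (toℕ (rank a))) →
    (∀ a → w (pos (toℕ a)) ≡ val (toℕ (rank a))) →
    Contains w p
  contains-by-ranks w p rank pos val pos↑ val↑ p≡rank w≡val =
    pos ∘ toℕ , (λ a b a<b → pos↑ a<b (toℕ<n b)) , λ a b → preserves a b , reflects a b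
    where
    preserves : ∀ a b → lookup p a ℕ.< lookup p b → w (pos (toℕ a)) < w (pos (toℕ b))
    preserves a b rewrite p≡rank a | p≡rank b | w≡val a | w≡val b =
      λ r<r′ → val↑ (ℕ.s≤s⁻¹ r<r′) (toℕ<n (rank b))
    reflects : ∀ a b → w (pos (toℕ a)) < w (pos (toℕ b)) → lookup p a ℕ.< lookup p b
    reflects a b rewrite p≡rank a | p≡rank b | w≡val a | w≡val b =
      s≤s ∘ strictlyIncreasingBelow-reflects val↑ (toℕ<n (rank a)) (toℕ<n (rank b))

  fourPoints : ℤ → ℤ → ℤ → ℤ → ℕ → ℤ
  fourPoints a b c d 0 = a
  fourPoints a b c d 1 = b
  fourPoints a b c d 2 = c
  fourPoints a b c d _ = d

  fourPoints-increasing : ∀ {a b c d} → a < b → b < c → c < d →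
    StrictlyIncreasingBelow 4 (fourPoints a b c d)
  fourPoints-increasing a<b b<c c<d = strictlyIncreasingBelow-by-steps 4 _ λ where
    0 _ → a<b
    1 _ → b<c
    2 _ → c<d
    (suc (suc (suc (suc _)))) (s≤s (s≤s (s≤s (s≤s ()))))

  fourCases : {P : Fin 4 → Set} → P 0F → P (sucF 0F) → P (sucF (sucF 0F)) →
    P (sucF (sucF (sucF 0F))) → ∀ a → P a
  fourCases p₀ p₁ p₂ p₃ 0F = p₀
  fourCases p₀ p₁ p₂ p₃ (sucF 0F) = p₁
  fourCases p₀ p₁ p₂ p₃ (sucF (sucF 0F)) = p₂
  fourCases p₀ p₁ p₂ p₃ (sucF (sucF (sucF 0F))) = p₃

  contains-3412 : ∀ w {i j k l} → i < j → j < k → k < l →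
    w k < w l → w l < w i → w i < w j → Contains w p3412
  contains-3412 w {i} {j} {k} {l} i<j j<k k<l wk<wl wl<wi wi<wj =
    contains-by-ranks w p3412 rank (fourPoints i j k l) (fourPoints (w k) (w l) (w i) (w j))
      (fourPoints-increasing i<j j<k k<l) (fourPoints-increasing wk<wl wl<wi wi<wj)
      (fourCases refl refl refl refl) (fourCases refl refl refl refl)
    where
    rank : Fin 4 → Fin 4
    rank = fourCases (sucF (sucF 0F)) (sucF (sucF (sucF 0F))) 0F (sucF 0F)

  contains-4231 : ∀ w {i j k l} → i < j → j < k → k < l →
    w l < w j → w j < w k → w k < w i → Contains w p4231
  contains-4231 w {i} {j} {k} {l} i<j j<k k<l wl<wj wj<wk wk<wi =
    contains-by-ranks w p4231 rank (fourPoints i j k l) (fourPoints (w l) (w j) (w k) (w i))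
      (fourPoints-increasing i<j j<k k<l) (fourPoints-increasing wl<wj wj<wk wk<wi)
      (fourCases refl refl refl refl) (fourCases refl refl refl refl)
    where
    rank : Fin 4 → Fin 4
    rank = fourCases (sucF (sucF (sucF 0F))) (sucF 0F) (sucF (sucF 0F)) 0F

module Intervals where
  open import Data.Integer using (_≤_; _<_; _+_; _-_; pred) renaming (suc to sucℤ)
  open import Data.Integer.Properties

  ≤⇒≡+ : ∀ {i j} → i ≤ j → Σ ℕ λ k → j ≡ i + + k
  ≤⇒≡+ {i} {j} i≤j = ℤ.∣ j - i ∣ , (begin
    j                 ≡⟨ j≡i+[j-i] i j ⟩
    i + (j - i)       ≡⟨ cong (λ x → i + x) (0≤i⇒+∣i∣≡i (i≤j⇒0≤j-i i≤j)) ⟨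
    i + + ℤ.∣ j - i ∣ ∎)
    where
    open ≡-Reasoning
    j≡i+[j-i] : ∀ i j → j ≡ i + (j - i)
    j≡i+[j-i] = solve-∀

  +-suc : ∀ i j → i + sucℤ j ≡ sucℤ (i + j)
  +-suc i j = trans (sym (+-assoc i 1ℤ j)) (trans (cong (_+ j) (+-comm i 1ℤ)) (+-assoc 1ℤ i j))

  ≤-induction : (P : ℤ → Set) {d : ℤ} → P d → (∀ {e} → d ≤ e → P e → P (sucℤ e)) →
    ∀ {e} → d ≤ e → P e
  ≤-induction P {d} base step d≤e with ≤⇒≡+ d≤e
  ... | k , refl = go k
    where
    go : ∀ k → P (d + + k)
    go zero    = subst P (sym (+-identityʳ d)) base
    go (suc k) = subst P (sym (+-suc d (+ k))) (step (i≤i+j d (+ k)) (go k))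

  DescendingOn : (ℤ → ℤ) → ℤ → ℤ → Set
  DescendingOn f d e = ∀ i → d ≤ i → i < e → f (sucℤ i) < f i

  AscentIn : (ℤ → ℤ) → ℤ → ℤ → Set
  AscentIn f d e = Σ ℤ λ i → d ≤ i × i < e × f i ≤ f (sucℤ i)

  <-suc⇒<⊎≡ : ∀ {i e} → i < sucℤ e → i < e ⊎ i ≡ e
  <-suc⇒<⊎≡ {i} {e} i<1+e with <-cmp i e
  ... | tri< i<e _ _ = inj₁ i<e
  ... | tri≈ _ i≡e _ = inj₂ i≡e
  ... | tri> _ _ e<i = ⊥-elim (<⇒≱ i<1+e (i<j⇒suc[i]≤j e<i))

  descending-or-ascent : ∀ f {d e} → d ≤ e → DescendingOn f d e ⊎ AscentIn f d e
  descending-or-ascent f {d} = ≤-induction (λ e → DescendingOn f d e ⊎ AscentIn f d e)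
    (inj₁ λ i d≤i i<d → ⊥-elim (<⇒≱ i<d d≤i)) extend
    where
    extend : ∀ {e} → d ≤ e → DescendingOn f d e ⊎ AscentIn f d e →
      DescendingOn f d (sucℤ e) ⊎ AscentIn f d (sucℤ e)
    extend _ (inj₂ (i , d≤i , i<e , ascent)) = inj₂ (i , d≤i , <-trans i<e (i<suc[i]) , ascent)
      where i<suc[i] = suc[i]≤j⇒i<j ≤-refl
    extend {e} d≤e (inj₁ descending) with f (sucℤ e) <? f e
    ... | yes step = inj₁ λ i d≤i i<1+e →
      [ descending i d≤i , (λ { refl → step }) ] (<-suc⇒<⊎≡ i<1+e)
    ... | no ¬step = inj₂ (e , d≤e , suc[i]≤j⇒i<j ≤-refl , ≮⇒≥ ¬step)

  record FactoringInterval (f : ℤ → ℤ) (d e : ℤ) : Set where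
    field
      d≤e         : d ≤ e
      descending  : DescendingOn f d e
      left-below  : ∀ i → i < d → f i < f d
      right-above : ∀ i → e < i → f e < f i
      condition₄  : (∀ i → i < d → f i < f e) → ∀ i → e < i → f d < f i

  factoringInterval⇒factoringSubword : ∀ {f d e} → FactoringInterval f d e → HasFactoringSubword f
  factoringInterval⇒factoringSubword {f} {d} I with ≤⇒≡+ (FactoringInterval.d≤e I)
  ... | m , refl = pred d , suc m , s≤s z≤n , descending′ , left-below′ , right-above′ , condition₄′
    where
    open FactoringInterval I
    first : pred d + + 1 ≡ d
    first = trans (+-comm (pred d) 1ℤ) (suc-pred d)
    last : pred d + + suc m ≡ d + + m
    last = begin
      pred d + + suc m      ≡⟨ +-suc (pred d) (+ m) ⟩
      sucℤ (pred d + + m)   ≡⟨ cong sucℤ (pred-+ d (+ m)) ⟩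
      sucℤ (pred (d + + m)) ≡⟨ suc-pred (d + + m) ⟩
      d + + m               ∎
      where open ≡-Reasoning
    descending′ : ∀ j → 1 ℕ.≤ j → j ℕ.< suc m → f (pred d + + suc j) < f (pred d + + j)
    descending′ j 1≤j j<1+m = subst (λ x → f x < f (pred d + + j)) (sym (+-suc (pred d) (+ j)))
      (descending _ (subst (_≤ pred d + + j) first (+-monoʳ-≤ (pred d) (+≤+ 1≤j)))
                    (subst (pred d + + j <_) last (+-monoʳ-< (pred d) (+<+ j<1+m))))
    left-below′ : ∀ i → i ≤ pred d → f i < f (pred d + + 1)
    left-below′ i i≤q rewrite first = left-below i (i≤pred[j]⇒i<j i≤q)
    right-above′ : ∀ i → pred d + + suc m < i → f (pred d + + suc m) < f i
    right-above′ rewrite last = right-above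
    condition₄′ : (∀ i → i ≤ pred d → f i < f (pred d + + suc m)) →
      ∀ i → pred d + + suc m < i → f (pred d + + 1) < f i
    condition₄′ rewrite first | last = λ below → condition₄ λ i i<d → below i (i<j⇒i≤pred[j] i<d)

module HalfLineExtrema where
  open import Data.Integer using (_≤_; _+_; _-_)
  open import Data.Integer.Properties
  open import Data.List.Extrema ≤-totalOrder
    using (argmin; argmax; argmin-all; argmax-all; f[argmin]≤f[xs]; f[xs]≤f[argmax])
  open Intervals using (≤⇒≡+)

  MinimumFrom : (ℤ → ℤ) → ℤ → ℤ → Set
  MinimumFrom w x m = x ≤ m × (∀ i → x ≤ i → w m ≤ w i)

  MaximumUpTo : (ℤ → ℤ) → ℤ → ℤ → Set
  MaximumUpTo w y d = d ≤ y × (∀ i → i ≤ y → w i ≤ w d)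

  -- Each half-line extremum is attained in the window of N positions next to the endpoint.
  module _ (N : ℕ) .{{_ : ℕ.NonZero N}} (w : ℤ → ℤ) (w≤w[+N] : ∀ i → w i ≤ w (i + + N)) where

    w≤w[+multiple] : ∀ t i → w i ≤ w (i + + (t ℕ.* N))
    w≤w[+multiple] zero    i = ≤-reflexive (cong w (sym (+-identityʳ i)))
    w≤w[+multiple] (suc t) i = begin
      w i                         ≤⟨ w≤w[+N] i ⟩
      w (i + + N)                 ≤⟨ w≤w[+multiple] t (i + + N) ⟩
      w (i + + N + + (t ℕ.* N))   ≡⟨ cong w (+-assoc i (+ N) (+ (t ℕ.* N))) ⟩
      w (i + (+ N + + (t ℕ.* N))) ≡⟨ cong (λ j → w (i + j)) (pos-+ N (t ℕ.* N)) ⟨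
      w (i + + (N ℕ.+ t ℕ.* N))   ∎
      where open ≤-Reasoning

    +-divMod : ∀ i k → i + + k ≡ (i + + (k % N)) + + ((k / N) ℕ.* N)
    +-divMod i k = begin
      i + + k                              ≡⟨ cong (λ k → i + + k) (m≡m%n+[m/n]*n k N) ⟩
      i + + (k % N ℕ.+ (k / N) ℕ.* N)      ≡⟨ cong (λ j → i + j) (pos-+ (k % N) _) ⟩
      i + (+ (k % N) + + ((k / N) ℕ.* N))  ≡⟨ +-assoc i _ _ ⟨
      i + + (k % N) + + ((k / N) ℕ.* N)    ∎
      where open ≡-Reasoning

    minimumFrom : ∀ x → Σ ℤ (MinimumFrom w x)
    minimumFrom x =
      m , argmin-all w {P = x ≤_} ≤-refl (applyUpTo⁺₂ _ N λ r → i≤i+j x (+ r)) , minimal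
      where
      window = applyUpTo (λ r → x + + r) N
      m = argmin w x window
      minimal : ∀ i → x ≤ i → w m ≤ w i
      minimal i x≤i with ≤⇒≡+ x≤i
      ... | k , refl = ≤-trans (applyUpTo⁻ _ N (f[argmin]≤f[xs] {f = w} x window) (m%n<n k N))
        (subst (λ j → w (x + + (k % N)) ≤ w j) (sym (+-divMod x k)) (w≤w[+multiple] (k / N) _))

    maximumUpTo : ∀ y → Σ ℤ (MaximumUpTo w y)
    maximumUpTo y =
      d , argmax-all w {P = _≤ y} ≤-refl (applyUpTo⁺₂ _ N λ r → i-j≤i y (+ r)) , maximal
      where
      window = applyUpTo (λ r → y - + r) N
      d = argmax w y window
      cancel : ∀ a b c → a + b + c - b ≡ a + c
      cancel = solve-∀
      maximal : ∀ i → i ≤ y → w i ≤ w d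
      maximal i i≤y with ≤⇒≡+ i≤y
      ... | k , refl = ≤-trans (subst (λ j → w i ≤ w j) shifted (w≤w[+multiple] (k / N) i))
        (applyUpTo⁻ _ N (f[xs]≤f[argmax] {f = w} y window) (m%n<n k N))
        where
        shifted : i + + ((k / N) ℕ.* N) ≡ i + + k - + (k % N)
        shifted = trans (sym (cancel i _ _)) (cong (_- + (k % N)) (sym (+-divMod i k)))

module Factoring
  (w w⁻¹ : ℤ → ℤ) (w⁻¹∘w : ∀ i → w⁻¹ (w i) ≡ i) (w∘w⁻¹ : ∀ i → w (w⁻¹ i) ≡ i)
  (avoids-3412 : Avoids w p3412) (avoids-4231 : Avoids w p4231)
  (minimumFrom : ∀ x → Σ ℤ (HalfLineExtrema.MinimumFrom w x))
  (maximumUpTo : ∀ y → Σ ℤ (HalfLineExtrema.MaximumUpTo w y))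
  where
  open import Data.Integer using (_≤_; _<_; pred) renaming (suc to sucℤ)
  open import Data.Integer.Properties
  open Patterns using (contains-3412; contains-4231)
  open Intervals
  open HalfLineExtrema using (MinimumFrom; MaximumUpTo)

  w-injective : ∀ {i j} → w i ≡ w j → i ≡ j
  w-injective {i} {j} eq = trans (sym (w⁻¹∘w i)) (trans (cong w⁻¹ eq) (w⁻¹∘w j))

  w⁻¹-injective : ∀ {u v} → w⁻¹ u ≡ w⁻¹ v → u ≡ v
  w⁻¹-injective {u} {v} eq = trans (sym (w∘w⁻¹ u)) (trans (cong w eq) (w∘w⁻¹ v))

  w-≤⇒< : ∀ {i j} → i ≢ j → w i ≤ w j → w i < w j
  w-≤⇒< i≢j wi≤wj = ≤∧≢⇒< wi≤wj (i≢j ∘ w-injective)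

  StrictMinimumAfter : ℤ → Set
  StrictMinimumAfter e = ∀ i → e < i → w e < w i

  -- The two ways condition (4) can hold for the block [d, e]: its premise fails, or its
  -- conclusion holds.
  Condition₄ : ℤ → ℤ → Set
  Condition₄ d e = (Σ ℤ λ i → i < d × w e < w i) ⊎ (∀ i → e < i → w d < w i)

  strictMinimumAfter⇒minimumFrom : ∀ {e} → StrictMinimumAfter e → ∀ i → e ≤ i → w e ≤ w i
  strictMinimumAfter⇒minimumFrom {e} min i e≤i with <-cmp e i
  ... | tri< e<i _ _ = <⇒≤ (min i e<i)
  ... | tri≈ _ refl _ = ≤-refl
  ... | tri> _ _ i<e = ⊥-elim (<⇒≱ i<e e≤i)

  above-maximum⇒w⁻¹-beyond : ∀ {d e} → MaximumUpTo w e d → ∀ {u} → w d < u → e < w⁻¹ u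
  above-maximum⇒w⁻¹-beyond (_ , maximal) {u} wd<u =
    ≰⇒> λ w⁻¹u≤e → <⇒≱ wd<u (subst (_≤ _) (w∘w⁻¹ u) (maximal _ w⁻¹u≤e))

  w-factoringInterval : ∀ {d e} → MaximumUpTo w e d → StrictMinimumAfter e → Condition₄ d e →
    DescendingOn w d e → FactoringInterval w d e
  w-factoringInterval (d≤e , maximal) min cond descending = record
    { d≤e         = d≤e
    ; descending  = descending
    ; left-below  = λ i i<d → w-≤⇒< (<⇒≢ i<d) (maximal i (≤-trans (<⇒≤ i<d) d≤e))
    ; right-above = min
    ; condition₄  = conclusion cond
    }
    where
    conclusion : Condition₄ _ _ → (∀ i → i < _ → w i < w _) → ∀ i → _ < i → w _ < w i
    conclusion (inj₁ (i , i<d , we<wi)) below = ⊥-elim (<-asym we<wi (below i i<d))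
    conclusion (inj₂ above) _ = above

  w⁻¹-factoringInterval : ∀ {d e} → MaximumUpTo w e d → StrictMinimumAfter e →
    DescendingOn w⁻¹ (w e) (w d) → FactoringInterval w⁻¹ (w e) (w d)
  w⁻¹-factoringInterval {d} {e} max@(d≤e , maximal) min descending = record
    { d≤e         = maximal e ≤-refl
    ; descending  = descending
    ; left-below  = λ u u<we → subst (w⁻¹ u <_) (sym (w⁻¹∘w e)) (below u<we)
    ; right-above = λ u wd<u →
        subst (_< w⁻¹ u) (sym (w⁻¹∘w d)) (≤-<-trans d≤e (above-maximum⇒w⁻¹-beyond max wd<u))
    ; condition₄  = λ _ u wd<u →
        subst (_< w⁻¹ u) (sym (w⁻¹∘w e)) (above-maximum⇒w⁻¹-beyond max wd<u)
    }
    where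
    below : ∀ {u} → u < w e → w⁻¹ u < e
    below {u} u<we = ≰⇒> λ e≤w⁻¹u →
      <⇒≱ u<we (subst (w e ≤_) (w∘w⁻¹ u) (strictMinimumAfter⇒minimumFrom min _ e≤w⁻¹u))

  no-increasing-pair-between : ∀ {d e i α β} → d ≤ e → (∀ j → e < j → w d < w j) →
    d < i → i < e → w i < w e → α < β → w e ≤ w α → w α < w β → w β ≤ w d → ⊥
  no-increasing-pair-between {d} {e} {α = α} {β} d≤e above d<i i<e wi<we α<β we≤wα wα<wβ wβ≤wd
    with <-cmp α d
  ... | tri< α<d _ _ = avoids-3412 (contains-3412 w α<d d<i i<e wi<we
          (w-≤⇒< (≢-sym (<⇒≢ (<-≤-trans α<d d≤e))) we≤wα) (<-≤-trans wα<wβ wβ≤wd))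
  ... | tri≈ _ refl _ = <⇒≱ wα<wβ wβ≤wd
  ... | tri> _ _ d<α with <-cmp β e
  ...   | tri< β<e _ _ = avoids-4231 (contains-4231 w d<α α<β β<e
            (w-≤⇒< (≢-sym (<⇒≢ (<-trans α<β β<e))) we≤wα) wα<wβ
            (w-≤⇒< (≢-sym (<⇒≢ (<-trans d<α α<β))) wβ≤wd))
  ...   | tri≈ _ refl _ = <⇒≱ wα<wβ we≤wα
  ...   | tri> _ _ e<β = <⇒≱ (above β e<β) wβ≤wd

  ascent⇒w⁻¹-factoring : ∀ {d e i j} → MaximumUpTo w e d → StrictMinimumAfter e → Condition₄ d e →
    d < i → i < j → j ≤ e → w i < w j → HasFactoringSubword w⁻¹
  ascent⇒w⁻¹-factoring {d} {e} {i} {j} max@(d≤e , maximal) min cond d<i i<j j≤e wi<wj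
    with <-cmp (w i) (w e)
  ... | tri≈ _ wi≡we _ = ⊥-elim (<⇒≢ (<-≤-trans i<j j≤e) (w-injective wi≡we))
  ... | tri> _ _ we<wi = ⊥-elim (avoids-4231 (contains-4231 w d<i i<j j<e we<wi wi<wj wj<wd))
    where
    j<e = ≤∧≢⇒< j≤e λ { refl → <-asym we<wi wi<wj }
    wj<wd = w-≤⇒< (≢-sym (<⇒≢ (<-trans d<i i<j))) (maximal j j≤e)
  ... | tri< wi<we _ _ with cond
  ...   | inj₁ (l , l<d , we<wl) = ⊥-elim (avoids-3412 (contains-3412 w l<d d<i (<-≤-trans i<j j≤e)
            wi<we we<wl (w-≤⇒< (<⇒≢ l<d) (maximal l (≤-trans (<⇒≤ l<d) d≤e)))))
  ...   | inj₂ above with descending-or-ascent w⁻¹ (maximal e ≤-refl)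
  ...     | inj₁ descending =
            factoringInterval⇒factoringSubword (w⁻¹-factoringInterval max min descending)
  ...     | inj₂ (u , we≤u , u<wd , w⁻¹u≤w⁻¹u+1) = ⊥-elim (no-increasing-pair-between d≤e above
            d<i (<-≤-trans i<j j≤e) wi<we
            (≤∧≢⇒< w⁻¹u≤w⁻¹u+1 (i≢suc[i] ∘ w⁻¹-injective))
            (subst (w e ≤_) (sym (w∘w⁻¹ u)) we≤u)
            (subst₂ _<_ (sym (w∘w⁻¹ u)) (sym (w∘w⁻¹ (sucℤ u))) (suc[i]≤j⇒i<j ≤-refl))
            (subst (_≤ w d) (sym (w∘w⁻¹ (sucℤ u))) (i<j⇒suc[i]≤j u<wd)))

  block⇒factoring : ∀ {d e} → MaximumUpTo w e d → StrictMinimumAfter e → Condition₄ d e →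
    HasFactoringSubword w ⊎ HasFactoringSubword w⁻¹
  block⇒factoring max@(d≤e , maximal) min cond with descending-or-ascent w d≤e
  ... | inj₁ descending =
    inj₁ (factoringInterval⇒factoringSubword (w-factoringInterval max min cond descending))
  ... | inj₂ (i , d≤i , i<e , wi≤wi+1) =
    inj₂ (ascent⇒w⁻¹-factoring max min cond d<i i<i+1 i+1≤e wi<wi+1)
    where
    i<i+1 = suc[i]≤j⇒i<j ≤-refl
    i+1≤e = i<j⇒suc[i]≤j i<e
    wi<wi+1 = w-≤⇒< (<⇒≢ i<i+1) wi≤wi+1
    d<i = ≤∧≢⇒< d≤i λ { refl → <⇒≱ wi<wi+1 (maximal _ i+1≤e) }

  -- e minimises w from a point m on, and d maximises w up to m; then the minimum of w after d
  -- cannot lie beyond m.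
  block-exists : Σ ℤ λ d → Σ ℤ λ e → MaximumUpTo w e d × MinimumFrom w d e
  block-exists with minimumFrom 0ℤ
  ... | m , 0≤m , m-minimal with maximumUpTo m
  ... | d , d≤m , d-maximal with minimumFrom d
  ... | e , d≤e , e-minimal =
    d , e , (d≤e , λ i i≤e → d-maximal i (≤-trans i≤e e≤m)) , d≤e , e-minimal
    where
    e≤m = ≮⇒≥ λ m<e → <-irrefl (w-injective
      (≤-antisym (m-minimal e (≤-trans 0≤m (<⇒≤ m<e))) (e-minimal m d≤m))) m<e

  factoring : HasFactoringSubword w ⊎ HasFactoringSubword w⁻¹
  factoring with block-exists
  ... | d , e , max@(d≤e , _) , _ , e-minimal with maximumUpTo (pred d)
  ... | d₀ , d₀≤pred-d , d₀-maximal with <-cmp (w e) (w d₀)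
  ... | tri< we<wd₀ _ _ = block⇒factoring max min (inj₁ (d₀ , i≤pred[j]⇒i<j d₀≤pred-d , we<wd₀))
    where
    min : StrictMinimumAfter e
    min i e<i = w-≤⇒< (<⇒≢ e<i) (e-minimal i (≤-trans d≤e (<⇒≤ e<i)))
  ... | tri≈ _ we≡wd₀ _ =
    ⊥-elim (<⇒≢ (<-≤-trans (i≤pred[j]⇒i<j d₀≤pred-d) d≤e) (sym (w-injective we≡wd₀)))
  ... | tri> _ _ wd₀<we = block⇒factoring (d₀≤pred-d , d₀-maximal) min (inj₂ above)
    where
    above : ∀ i → pred d < i → w d₀ < w i
    above i pred-d<i =
      <-≤-trans wd₀<we (e-minimal i (subst (_≤ i) (suc-pred d) (i<j⇒suc[i]≤j pred-d<i)))
    min : StrictMinimumAfter (pred d)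
    min i pred-d<i = ≤-<-trans (d₀-maximal (pred d) ≤-refl) (above i pred-d<i)

open import Data.Nat using (_≤_)

lemma3p5 : (n : ℕ) → 1 ≤ n → (w winv : ℤ → ℤ) → IsAffinePerm n w winv →
    Avoids w p3412 → Avoids w p4231 →
    HasFactoringSubword w ⊎ HasFactoringSubword winv
lemma3p5 (suc n) _ w winv (winv∘w , w∘winv , periodic , _) avoids-3412 avoids-4231 =
  Factoring.factoring w winv winv∘w w∘winv avoids-3412 avoids-4231
    (minimumFrom (suc n) w w≤w[+n]) (maximumUpTo (suc n) w w≤w[+n])
  where
  open HalfLineExtrema using (minimumFrom; maximumUpTo)
  w≤w[+n] : ∀ i → w i ℤ.≤ w (i ℤ.+ + suc n)
  w≤w[+n] i = subst (w i ℤ.≤_) (sym (periodic i)) (ℤ.i≤i+j (w i) (+ suc n))
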